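{- Let $\mathcal{C}$ and $\mathcal{D}$ be gs-monoidal categories and $F:\mathcal{C}\to\mathcal{D}$ a lax symmetric monoidal functor. If $\mathcal{D}$ is a restriction category, then $F$ is mass preserving if and only if it is unital domain preserving.
   Context: Composition is diagrammatic ($f;g$ means first $f$, then $g$); the right unitor is $\rho_X:X\to X\otimes I$. A gs-monoidal category is a symmetric monoidal category with, for each object $X$, a discharger $!_X:X\to I$ and duplicator $\nabla_X:X\to X\otimes X$, compatible with the monoidal structure, with $\nabla_X$ coassociative, cocommutative, and $(X,\nabla_X,!_X)$ a comonoid. A restriction category (with restriction products) is a gs-monoidal category in which every arrow $f:X\to Y$ satisfies $f;\nabla_Y=\nabla_X;(f\otimes f)$. $F$ lax symmetric monoidal has structure arrows $\psi_{X,Y}:F(X)\otimes F(Y)\to F(X\otimes Y)$, $\psi_0:I\to F(I)$. $F$ is unital domain preserving if $\nabla_{F(I)};\psi_{I,I};F(\mathrm{id}_I\otimes !_I)=F(\rho_I)$. $F$ is mass preserving if for all $X$: $\nabla_{F(X)};\psi_{X,X};F(!_X\otimes !_X)=F(!_X);F(\rho_I)$. -}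

module Defs where

open import Level using (Level; _⊔_; suc)
open import Relation.Binary using (Rel; IsEquivalence)

-- Categories with setoid-valued hom equality⨾ composition is DIAGRAMMATIC:
-- f ⨾ g  means first f, then g.
record Category (o ℓ e : Level) : Set (suc (o ⊔ ℓ ⊔ e)) where
  infixr 9 _⨾_
  infix  4 _≈_
  field
    Obj   : Set o
    _⇒_   : Obj → Obj → Set ℓ
    _≈_   : ∀ {A B} → Rel (A ⇒ B) e
    id    : ∀ {A} → A ⇒ A
    _⨾_   : ∀ {A B C} → A ⇒ B → B ⇒ C → A ⇒ C
    equiv : ∀ {A B} → IsEquivalence (_≈_ {A} {B})
    assoc : ∀ {A B C D} {f : A ⇒ B} {g : B ⇒ C} {h : C ⇒ D} →
            (f ⨾ g) ⨾ h ≈ f ⨾ (g ⨾ h)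
    identityˡ : ∀ {A B} {f : A ⇒ B} → id ⨾ f ≈ f
    identityʳ : ∀ {A B} {f : A ⇒ B} → f ⨾ id ≈ f
    ⨾-resp-≈  : ∀ {A B C} {f f′ : A ⇒ B} {g g′ : B ⇒ C} →
                f ≈ f′ → g ≈ g′ → f ⨾ g ≈ f′ ⨾ g′

-- Symmetric monoidal categories.  Unitors point INTO the tensor, as in the
-- paper: ρ X : X → X ⊗ I, and λ′ X : X → I ⊗ X⨾ associator
-- α : (X ⊗ Y) ⊗ Z → X ⊗ (Y ⊗ Z).  All three are isomorphisms.
record SymmetricMonoidal (o ℓ e : Level) : Set (suc (o ⊔ ℓ ⊔ e)) where
  field
    cat : Category o ℓ e
  open Category cat public
  infixr 10 _⊗₀_ _⊗₁_
  field
    _⊗₀_ : Obj → Obj → Obj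
    _⊗₁_ : ∀ {A B C D} → A ⇒ B → C ⇒ D → (A ⊗₀ C) ⇒ (B ⊗₀ D)
    I    : Obj
    ⊗-id   : ∀ {A B} → (id {A}) ⊗₁ (id {B}) ≈ id
    ⊗-comp : ∀ {A B C A′ B′ C′} {f : A ⇒ B} {g : B ⇒ C} {h : A′ ⇒ B′} {k : B′ ⇒ C′} →
             (f ⨾ g) ⊗₁ (h ⨾ k) ≈ (f ⊗₁ h) ⨾ (g ⊗₁ k)
    ⊗-resp-≈ : ∀ {A B C D} {f f′ : A ⇒ B} {g g′ : C ⇒ D} →
               f ≈ f′ → g ≈ g′ → f ⊗₁ g ≈ f′ ⊗₁ g′
    α    : ∀ {X Y Z} → ((X ⊗₀ Y) ⊗₀ Z) ⇒ (X ⊗₀ (Y ⊗₀ Z))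
    α⁻¹  : ∀ {X Y Z} → (X ⊗₀ (Y ⊗₀ Z)) ⇒ ((X ⊗₀ Y) ⊗₀ Z)
    α-iso₁ : ∀ {X Y Z} → α {X} {Y} {Z} ⨾ α⁻¹ ≈ id
    α-iso₂ : ∀ {X Y Z} → α⁻¹ ⨾ α {X} {Y} {Z} ≈ id
    α-natural : ∀ {X Y Z X′ Y′ Z′} {f : X ⇒ X′} {g : Y ⇒ Y′} {h : Z ⇒ Z′} →
                ((f ⊗₁ g) ⊗₁ h) ⨾ α ≈ α ⨾ (f ⊗₁ (g ⊗₁ h))
    ρ    : ∀ {X} → X ⇒ (X ⊗₀ I)
    ρ⁻¹  : ∀ {X} → (X ⊗₀ I) ⇒ X
    ρ-iso₁ : ∀ {X} → ρ {X} ⨾ ρ⁻¹ ≈ id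
    ρ-iso₂ : ∀ {X} → ρ⁻¹ ⨾ ρ {X} ≈ id
    ρ-natural : ∀ {X Y} {f : X ⇒ Y} → f ⨾ ρ ≈ ρ ⨾ (f ⊗₁ id)
    λ′   : ∀ {X} → X ⇒ (I ⊗₀ X)
    λ′⁻¹ : ∀ {X} → (I ⊗₀ X) ⇒ X
    λ-iso₁ : ∀ {X} → λ′ {X} ⨾ λ′⁻¹ ≈ id
    λ-iso₂ : ∀ {X} → λ′⁻¹ ⨾ λ′ {X} ≈ id
    λ-natural : ∀ {X Y} {f : X ⇒ Y} → f ⨾ λ′ ≈ λ′ ⨾ (id ⊗₁ f)
    σ    : ∀ {X Y} → (X ⊗₀ Y) ⇒ (Y ⊗₀ X)
    σ-natural : ∀ {X Y X′ Y′} {f : X ⇒ X′} {g : Y ⇒ Y′} →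
                (f ⊗₁ g) ⨾ σ ≈ σ ⨾ (g ⊗₁ f)
    σ-involutive : ∀ {X Y} → σ {X} {Y} ⨾ σ ≈ id
    triangle : ∀ {X Y} → (ρ {X} ⊗₁ id {Y}) ⨾ α ≈ id ⊗₁ λ′
    pentagon : ∀ {W X Y Z} →
               (α {W} {X} {Y} ⊗₁ id {Z}) ⨾ α ⨾ (id ⊗₁ α) ≈ α ⨾ α
    hexagon  : ∀ {X Y Z} →
               α {X} {Y} {Z} ⨾ σ ⨾ α ≈ (σ ⊗₁ id) ⨾ α ⨾ (id ⊗₁ σ)

-- gs-monoidal categories: each object carries a commutative comonoid
-- (∇, !) compatible with the monoidal structure (no naturality required).
record GSMonoidal (o ℓ e : Level) : Set (suc (o ⊔ ℓ ⊔ e)) where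
  field
    smc : SymmetricMonoidal o ℓ e
  open SymmetricMonoidal smc public
  interchange : ∀ {X Y} → ((X ⊗₀ X) ⊗₀ (Y ⊗₀ Y)) ⇒ ((X ⊗₀ Y) ⊗₀ (X ⊗₀ Y))
  interchange = α ⨾ (id ⊗₁ α⁻¹) ⨾ (id ⊗₁ (σ ⊗₁ id)) ⨾ (id ⊗₁ α) ⨾ α⁻¹
  field
    ! : ∀ X → X ⇒ I
    ∇ : ∀ X → X ⇒ (X ⊗₀ X)
    ∇-coassoc : ∀ {X} → ∇ X ⨾ (∇ X ⊗₁ id) ⨾ α ≈ ∇ X ⨾ (id ⊗₁ ∇ X)
    ∇-counitˡ : ∀ {X} → ∇ X ⨾ (! X ⊗₁ id) ≈ λ′
    ∇-counitʳ : ∀ {X} → ∇ X ⨾ (id ⊗₁ ! X) ≈ ρ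
    ∇-cocomm  : ∀ {X} → ∇ X ⨾ σ ≈ ∇ X
    !-unit  : ! I ≈ id
    ∇-unit  : ∇ I ≈ ρ
    !-⊗     : ∀ {X Y} → ! (X ⊗₀ Y) ⨾ ρ ≈ ! X ⊗₁ ! Y
    ∇-⊗     : ∀ {X Y} → ∇ (X ⊗₀ Y) ≈ (∇ X ⊗₁ ∇ Y) ⨾ interchange

-- Restriction category (with restriction products): every arrow commutes
-- with duplication.
IsRestriction : ∀ {o ℓ e} → GSMonoidal o ℓ e → Set (o ⊔ ℓ ⊔ e)
IsRestriction D = ∀ {X Y} (f : X ⇒ Y) → f ⨾ ∇ Y ≈ ∇ X ⨾ (f ⊗₁ f)
  where open GSMonoidal D

record LaxSymMonoidalFunctor {o ℓ e o′ ℓ′ e′ : Level}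
    (C : GSMonoidal o ℓ e) (D : GSMonoidal o′ ℓ′ e′)
    : Set (o ⊔ ℓ ⊔ e ⊔ o′ ⊔ ℓ′ ⊔ e′) where
  private
    module C = GSMonoidal C
    module D = GSMonoidal D
  field
    F₀ : C.Obj → D.Obj
    F₁ : ∀ {A B} → A C.⇒ B → F₀ A D.⇒ F₀ B
    F-id   : ∀ {A} → F₁ (C.id {A}) D.≈ D.id
    F-comp : ∀ {A B C′} {f : A C.⇒ B} {g : B C.⇒ C′} →
             F₁ (f C.⨾ g) D.≈ F₁ f D.⨾ F₁ g
    F-resp-≈ : ∀ {A B} {f g : A C.⇒ B} → f C.≈ g → F₁ f D.≈ F₁ g
    ψ  : ∀ X Y → (F₀ X D.⊗₀ F₀ Y) D.⇒ F₀ (X C.⊗₀ Y)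
    ψ₀ : D.I D.⇒ F₀ C.I
    ψ-natural : ∀ {X Y X′ Y′} {f : X C.⇒ X′} {g : Y C.⇒ Y′} →
                (F₁ f D.⊗₁ F₁ g) D.⨾ ψ X′ Y′ D.≈ ψ X Y D.⨾ F₁ (f C.⊗₁ g)
    ψ-assoc : ∀ {X Y Z} →
              (ψ X Y D.⊗₁ D.id) D.⨾ ψ (X C.⊗₀ Y) Z D.⨾ F₁ C.α
              D.≈ D.α D.⨾ (D.id D.⊗₁ ψ Y Z) D.⨾ ψ X (Y C.⊗₀ Z)
    ψ-unitˡ : ∀ {X} → D.λ′ D.⨾ (ψ₀ D.⊗₁ D.id) D.⨾ ψ C.I X D.≈ F₁ (C.λ′ {X})
    ψ-unitʳ : ∀ {X} → D.ρ D.⨾ (D.id D.⊗₁ ψ₀) D.⨾ ψ X C.I D.≈ F₁ (C.ρ {X})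
    ψ-sym   : ∀ {X Y} → D.σ D.⨾ ψ Y X D.≈ ψ X Y D.⨾ F₁ C.σ

module _ {o ℓ e o′ ℓ′ e′ : Level}
    {C : GSMonoidal o ℓ e} {D : GSMonoidal o′ ℓ′ e′}
    (F : LaxSymMonoidalFunctor C D) where
  private
    module C = GSMonoidal C
    module D = GSMonoidal D
  open LaxSymMonoidalFunctor F

  UnitalDomainPreserving : Set e′
  UnitalDomainPreserving =
    D.∇ (F₀ C.I) D.⨾ ψ C.I C.I D.⨾ F₁ (C.id C.⊗₁ C.! C.I) D.≈ F₁ (C.ρ {C.I})

  MassPreserving : Set (o ⊔ e′)
  MassPreserving = ∀ X →
    D.∇ (F₀ X) D.⨾ ψ X X D.⨾ F₁ (C.! X C.⊗₁ C.! X) D.≈ F₁ (C.! X) D.⨾ F₁ (C.ρ {C.I})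

{-# OPTIONS --safe #-}
module Submission where

open import Level using (Level)
open import Defs
open import Function.Bundles using (_⇔_; mk⇔)
open import Relation.Binary.Bundles using (Setoid)
open import Relation.Binary.Structures using (IsEquivalence)
import Relation.Binary.Reasoning.Setoid as SetoidReasoning

-- Since !_I ≈ id, both properties at I reduce to ∇_{F(I)} ⨾ ψ_{I,I} ≈ F(ρ_I); this
-- already gives mass preservation ⇒ unital domain preservation.  Conversely, in a
-- restriction category F(!_X) commutes with duplication, so by naturality of ψ
-- the arrow ∇ ⨾ ψ ⨾ F(!_X ⊗ !_X) factors as F(!_X) followed by ∇_{F(I)} ⨾ ψ_{I,I}.

module HomReasoning {o ℓ e : Level} (𝒞 : Category o ℓ e) where
  open Category 𝒞

  hom-setoid : Obj → Obj → Setoid ℓ e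
  hom-setoid A B = record { Carrier = A ⇒ B ; _≈_ = _≈_ ; isEquivalence = equiv }

  module Equiv {A B : Obj} = IsEquivalence (equiv {A} {B})

  infixr 4 refl⟩⨾⟨_
  infixl 5 _⟩⨾⟨refl

  refl⟩⨾⟨_ : ∀ {A B C} {f : A ⇒ B} {g g′ : B ⇒ C} → g ≈ g′ → f ⨾ g ≈ f ⨾ g′
  refl⟩⨾⟨ g≈g′ = ⨾-resp-≈ Equiv.refl g≈g′

  _⟩⨾⟨refl : ∀ {A B C} {f f′ : A ⇒ B} {g : B ⇒ C} → f ≈ f′ → f ⨾ g ≈ f′ ⨾ g
  f≈f′ ⟩⨾⟨refl = ⨾-resp-≈ f≈f′ Equiv.refl

module _ {o ℓ e o′ ℓ′ e′ : Level} {C : GSMonoidal o ℓ e} {D : GSMonoidal o′ ℓ′ e′}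
         (F : LaxSymMonoidalFunctor C D) where
  private
    module C = GSMonoidal C
    module D = GSMonoidal D
    module CE = HomReasoning.Equiv C.cat
  open LaxSymMonoidalFunctor F
  open HomReasoning D.cat

  copy : ∀ X → F₀ X D.⇒ F₀ (X C.⊗₀ X)
  copy X = D.∇ (F₀ X) D.⨾ ψ X X

  F-≈id : ∀ {A} {f : A C.⇒ A} → f C.≈ C.id → F₁ f D.≈ D.id
  F-≈id f≈id = Equiv.trans (F-resp-≈ f≈id) F-id

  F-!I≈id : F₁ (C.! C.I) D.≈ D.id
  F-!I≈id = F-≈id {C.I} C.!-unit

  F-id⊗!I≈id : F₁ (C.id C.⊗₁ C.! C.I) D.≈ D.id
  F-id⊗!I≈id = F-≈id {C.I C.⊗₀ C.I} (CE.trans (C.⊗-resp-≈ CE.refl C.!-unit) C.⊗-id)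

  copy-I≈F-ρ : UnitalDomainPreserving F → copy C.I D.≈ F₁ C.ρ
  copy-I≈F-ρ udp = begin
    copy C.I                                       ≈⟨ D.identityʳ ⟨
    copy C.I D.⨾ D.id                              ≈⟨ refl⟩⨾⟨ F-id⊗!I≈id ⟨
    copy C.I D.⨾ F₁ (C.id C.⊗₁ C.! C.I)            ≈⟨ D.assoc ⟩
    D.∇ _ D.⨾ ψ C.I C.I D.⨾ F₁ (C.id C.⊗₁ C.! C.I) ≈⟨ udp ⟩
    F₁ C.ρ                                         ∎
    where open SetoidReasoning (hom-setoid _ _)

  copy-natural : IsRestriction D → ∀ {X Y} (f : X C.⇒ Y) →
                 copy X D.⨾ F₁ (f C.⊗₁ f) D.≈ F₁ f D.⨾ copy Y
  copy-natural restriction {X} {Y} f = begin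
    (D.∇ _ D.⨾ ψ X X) D.⨾ F₁ (f C.⊗₁ f)    ≈⟨ D.assoc ⟩
    D.∇ _ D.⨾ ψ X X D.⨾ F₁ (f C.⊗₁ f)      ≈⟨ refl⟩⨾⟨ ψ-natural ⟨
    D.∇ _ D.⨾ (F₁ f D.⊗₁ F₁ f) D.⨾ ψ Y Y   ≈⟨ D.assoc ⟨
    (D.∇ _ D.⨾ (F₁ f D.⊗₁ F₁ f)) D.⨾ ψ Y Y ≈⟨ restriction (F₁ f) ⟩⨾⟨refl ⟨
    (F₁ f D.⨾ D.∇ _) D.⨾ ψ Y Y             ≈⟨ D.assoc ⟩
    F₁ f D.⨾ copy Y                        ∎
    where open SetoidReasoning (hom-setoid _ _)

  massPreserving⇒unitalDomainPreserving : MassPreserving F → UnitalDomainPreserving F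
  massPreserving⇒unitalDomainPreserving mass = begin
    D.∇ _ D.⨾ ψ C.I C.I D.⨾ F₁ (C.id C.⊗₁ C.! C.I)      ≈⟨ refl⟩⨾⟨ refl⟩⨾⟨ F-resp-≈ id⊗!I≈!I⊗!I ⟩
    D.∇ _ D.⨾ ψ C.I C.I D.⨾ F₁ (C.! C.I C.⊗₁ C.! C.I)   ≈⟨ mass C.I ⟩
    F₁ (C.! C.I) D.⨾ F₁ C.ρ                              ≈⟨ F-!I≈id ⟩⨾⟨refl ⟩
    D.id D.⨾ F₁ C.ρ                                      ≈⟨ D.identityˡ ⟩
    F₁ C.ρ                                               ∎
    where
      open SetoidReasoning (hom-setoid _ _)
      id⊗!I≈!I⊗!I : C.id C.⊗₁ C.! C.I C.≈ C.! C.I C.⊗₁ C.! C.I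
      id⊗!I≈!I⊗!I = C.⊗-resp-≈ (CE.sym C.!-unit) CE.refl

  unitalDomainPreserving⇒massPreserving : IsRestriction D →
    UnitalDomainPreserving F → MassPreserving F
  unitalDomainPreserving⇒massPreserving restriction udp X = begin
    D.∇ _ D.⨾ ψ X X D.⨾ F₁ (C.! X C.⊗₁ C.! X) ≈⟨ D.assoc ⟨
    copy X D.⨾ F₁ (C.! X C.⊗₁ C.! X)          ≈⟨ copy-natural restriction (C.! X) ⟩
    F₁ (C.! X) D.⨾ copy C.I                   ≈⟨ refl⟩⨾⟨ copy-I≈F-ρ udp ⟩
    F₁ (C.! X) D.⨾ F₁ C.ρ                     ∎
    where open SetoidReasoning (hom-setoid _ _)

lemma4p4 : ∀ {o ℓ e o′ ℓ′ e′} (C : GSMonoidal o ℓ e) (D : GSMonoidal o′ ℓ′ e′)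
             (F : LaxSymMonoidalFunctor C D) →
             IsRestriction D →
             (MassPreserving F ⇔ UnitalDomainPreserving F)
lemma4p4 C D F restriction =
  mk⇔ (massPreserving⇒unitalDomainPreserving F)
      (unitalDomainPreserving⇒massPreserving F restriction)
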